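{- Let $X$ be a set, $\mathcal{C}$ a simplicial complex on $X$, $\mathcal{L}$ a language of regular logic whose variables include $X$, $\vdash$ a regular theory in $\mathcal{L}$, and $[\![-]\!]$ a conservative model of $\vdash$ in a regular category $\mathbf{S}$, i.e. for any set $\Gamma$ of formulas and formula $\varphi$ (in a context $U$ containing the free variables involved), $\bigwedge_{\psi\in\Delta}[\![\psi]\!]_U\leqslant[\![\varphi]\!]_U$ for some finite $\Delta\subseteq\Gamma$ if and only if $\Gamma\vdash\varphi$. Then for all $\Gamma\subseteq\Phi_{\mathcal{C}}$ and $\varphi\in\Phi_{\mathcal{C}}$: $\Gamma\vdash_{\mathcal{C}}\varphi$ if and only if $G\vDash\varphi$ for every filter model $G$ of $\Gamma$ in $[\![-]\!]$.
   Context: A simplicial complex on $X$ is a family $\mathcal{C}$ of finite subsets of $X$ closed under subsets with $\bigcup\mathcal{C}=X$. $\mathcal{L}$ is a language of regular first-order logic (with $\top$, $\wedge$, $\exists$) whose variables include $X$; each $x\in X$ has a type $T_x$. $\Phi_U$ ($U\subseteq X$) is the set of formulas in context $U$; $\Phi_{\mathcal{C}}=\bigcup_{U\in\mathcal{C}}\Phi_U$; $\Gamma_U=\Gamma\cap\Phi_U$. $\vdash$ is an entailment relation between sets of formulas and formulas. The inchworm fragment $\vdash_{\mathcal{C}}$ is defined inductively: (i) $\Gamma\vdash_{\mathcal{C}}\varphi$ if some $U\in\mathcal{C}$ has $\varphi\in\Phi_U$ and $\Gamma_U\vdash\varphi$; (ii) if $\Gamma\vdash_{\mathcal{C}}\varphi$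 and $\Delta\cup\{\varphi\}\vdash_{\mathcal{C}}\psi$ then $\Gamma\cup\Delta\vdash_{\mathcal{C}}\psi$. An interpretation $[\![-]\!]$ of $\mathcal{L}$ in $\mathbf{S}$ gives $F_U=\prod_{x\in U}[\![T_x]\!]$ with projections $F_{U\subseteq V}:F_V\to F_U$, and subobjects $[\![\varphi]\!]_U\rightarrowtail F_U$ for $\varphi\in\Phi_U$. For $f$ an arrow, $f^{ -1}$ is pullback of subobjects and $\exists_f$ its left adjoint (image). A filter model in $[\![-]\!]$ is a presheaf $G:\mathcal{C}^{\mathrm{op}}\to\mathbf{Sets}$ such that each $G_U$ is a filter in $\mathrm{Sub}_{\mathbf{S}}(F_U)$, and for $U\subseteq V\in\mathcal{C}$, $G_U=\{S\rightarrowtail F_U\mid F_{U\subseteq V}^{ -1}(S)\in G_V\}=\{\exists_{F_{U\subseteq V}}(S)\mid S\in G_V\}$, with $G_{U\subseteq V}:S\mapsto\exists_{F_{U\subseteq V}}(S)$. $G\vDash\varphi$ means $[\![\varphi]\!]_U\in G_U$ whenever $U\in\mathcal{C}$ and $\varphi\in\Phi_U$; $G$ is a filter model of $\Gamma$ if $G\vDash\psi$ for all $\psi\in\Gamma$. -}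

module Defs where

open import Level using (Level; _⊔_; 0ℓ) renaming (suc to lsuc)
open import Data.Product using (Σ; Σ-syntax; _×_; _,_; proj₁; proj₂)
open import Data.Sum using (_⊎_; inj₁; inj₂)
open import Data.List using (List; []; _∷_; _++_; filter)
open import Data.List.Membership.Propositional using (_∈_)
open import Data.List.Membership.Propositional.Properties using (∈-filter⁺; ∈-filter⁻; ∈-++⁺ˡ; ∈-++⁺ʳ)
open import Data.List.Relation.Unary.Any using (here; there)
open import Data.List.Relation.Unary.All using (All; []; _∷_)
open import Data.List.Relation.Unary.Unique.Propositional using (Unique)
open import Data.List.Relation.Binary.Subset.Propositional using (_⊆_)
open import Relation.Binary using (IsEquivalence; DecidableEquality)
open import Relation.Binary.PropositionalEquality using (_≡_; refl)
open import Relation.Nullary using (¬_; ¬?; yes; no)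
open import Relation.Unary using (Pred; _≐_)

record Category (o h e : Level) : Set (lsuc (o ⊔ h ⊔ e)) where
  infixr 9 _∘_
  infix 4 _≈_
  infixr 1 _⇒_
  field
    Obj  : Set o
    _⇒_  : Obj → Obj → Set h
    _≈_  : ∀ {A B} → A ⇒ B → A ⇒ B → Set e
    ≈-equiv : ∀ {A B} → IsEquivalence (_≈_ {A} {B})
    id   : ∀ {A} → A ⇒ A
    _∘_  : ∀ {A B C} → B ⇒ C → A ⇒ B → A ⇒ C
    assoc : ∀ {A B C D} {f : A ⇒ B} {g : B ⇒ C} {k : C ⇒ D} →
            (k ∘ g) ∘ f ≈ k ∘ (g ∘ f)
    identityˡ : ∀ {A B} {f : A ⇒ B} → id ∘ f ≈ f
    identityʳ : ∀ {A B} {f : A ⇒ B} → f ∘ id ≈ f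
    ∘-resp-≈ : ∀ {A B C} {f f' : B ⇒ C} {g g' : A ⇒ B} →
               f ≈ f' → g ≈ g' → f ∘ g ≈ f' ∘ g'

module CatNotions {o h e : Level} (𝒞 : Category o h e) where
  open Category 𝒞

  Mono : ∀ {A B} → A ⇒ B → Set (o ⊔ h ⊔ e)
  Mono {A} f = ∀ {C} (g k : C ⇒ A) → f ∘ g ≈ f ∘ k → g ≈ k

  IsPullback : ∀ {A B C P} → A ⇒ C → B ⇒ C → P ⇒ A → P ⇒ B → Set (o ⊔ h ⊔ e)
  IsPullback {A} {B} {C} {P} f g p₁ p₂ =
    (f ∘ p₁ ≈ g ∘ p₂) ×
    (∀ {Q} (q₁ : Q ⇒ A) (q₂ : Q ⇒ B) → f ∘ q₁ ≈ g ∘ q₂ →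
      Σ[ u ∈ Q ⇒ P ] ((p₁ ∘ u ≈ q₁) × (p₂ ∘ u ≈ q₂)) ×
        (∀ (u' : Q ⇒ P) → p₁ ∘ u' ≈ q₁ → p₂ ∘ u' ≈ q₂ → u' ≈ u))

  IsEqualizer : ∀ {A B E} → A ⇒ B → A ⇒ B → E ⇒ A → Set (o ⊔ h ⊔ e)
  IsEqualizer {A} {B} {E} f g m =
    (f ∘ m ≈ g ∘ m) ×
    (∀ {Q} (q : Q ⇒ A) → f ∘ q ≈ g ∘ q →
      Σ[ u ∈ Q ⇒ E ] (m ∘ u ≈ q) × (∀ (u' : Q ⇒ E) → m ∘ u' ≈ q → u' ≈ u))

  IsCoequalizer : ∀ {A B Q} → A ⇒ B → A ⇒ B → B ⇒ Q → Set (o ⊔ h ⊔ e)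
  IsCoequalizer {A} {B} {Q} f g c =
    (c ∘ f ≈ c ∘ g) ×
    (∀ {R} (r : B ⇒ R) → r ∘ f ≈ r ∘ g →
      Σ[ u ∈ Q ⇒ R ] (u ∘ c ≈ r) × (∀ (u' : Q ⇒ R) → u' ∘ c ≈ r → u' ≈ u))

  RegularEpi : ∀ {B Q} → B ⇒ Q → Set (o ⊔ h ⊔ e)
  RegularEpi {B} {Q} c = Σ[ A ∈ Obj ] Σ[ f ∈ A ⇒ B ] Σ[ g ∈ A ⇒ B ] IsCoequalizer f g c

  IsListProduct : {I : Set} (W : List I) (F : I → Obj) (P : Obj) →
                  (∀ {x} → x ∈ W → P ⇒ F x) → Set (o ⊔ h ⊔ e)
  IsListProduct W F P π =
    ∀ {Q} (g : ∀ {x} → x ∈ W → Q ⇒ F x) →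
      Σ[ u ∈ Q ⇒ P ] (∀ {x} (p : x ∈ W) → π p ∘ u ≈ g p) ×
        (∀ (u' : Q ⇒ P) → (∀ {x} (p : x ∈ W) → π p ∘ u' ≈ g p) → u' ≈ u)

  record Pullback {A B C} (f : A ⇒ C) (g : B ⇒ C) : Set (o ⊔ h ⊔ e) where
    field
      P  : Obj
      p₁ : P ⇒ A
      p₂ : P ⇒ B
      isPullback : IsPullback f g p₁ p₂

  record Equalizer {A B} (f g : A ⇒ B) : Set (o ⊔ h ⊔ e) where
    field
      E : Obj
      eq : E ⇒ A
      isEqualizer : IsEqualizer f g eq

  record Factorization {A B} (f : A ⇒ B) : Set (o ⊔ h ⊔ e) where
    field
      Im : Obj
      m : Im ⇒ B
      q : A ⇒ Im
      m-mono : Mono m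
      q-regEpi : RegularEpi q
      factors : m ∘ q ≈ f

record RegularCategory (o h e : Level) : Set (lsuc (o ⊔ h ⊔ e)) where
  field
    cat : Category o h e
  open Category cat public
  open CatNotions cat public
  field
    prod : {I : Set} → List I → (I → Obj) → Obj
    proj : {I : Set} {W : List I} {F : I → Obj} {x : I} → x ∈ W → prod W F ⇒ F x
    prod-isProduct : {I : Set} (W : List I) (F : I → Obj) →
                     IsListProduct W F (prod W F) proj
    pullback : ∀ {A B C} (f : A ⇒ C) (g : B ⇒ C) → Pullback f g
    equalizer : ∀ {A B} (f g : A ⇒ B) → Equalizer f g
    factorize : ∀ {A B} (f : A ⇒ B) → Factorization f
    regEpi-pullback-stable :
      ∀ {A B C P} (f : A ⇒ C) (c : B ⇒ C) (p₁ : P ⇒ A) (p₂ : P ⇒ B) →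
      RegularEpi c → IsPullback f c p₁ p₂ → RegularEpi p₁

  ⟨_⟩ : {I : Set} {W : List I} {F : I → Obj} {Q : Obj} →
        (∀ {x} → x ∈ W → Q ⇒ F x) → Q ⇒ prod W F
  ⟨_⟩ {W = W} {F} g = proj₁ (prod-isProduct W F g)

module Subobjects {o h e : Level} (𝐒 : RegularCategory o h e) where
  open RegularCategory 𝐒

  record Sub (A : Obj) : Set (o ⊔ h ⊔ e) where
    constructor sub
    field
      dom : Obj
      arr : dom ⇒ A
      mono : Mono arr
  open Sub public

  infix 4 _≤_ _≅_
  _≤_ : ∀ {A} → Sub A → Sub A → Set (h ⊔ e)
  S ≤ T = Σ[ k ∈ dom S ⇒ dom T ] (arr T ∘ k ≈ arr S)

  _≅_ : ∀ {A} → Sub A → Sub A → Set (h ⊔ e)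
  S ≅ T = (S ≤ T) × (T ≤ S)

  im : ∀ {A B} → A ⇒ B → Sub B
  im f = sub (Factorization.Im F) (Factorization.m F) (Factorization.m-mono F)
    where F = factorize f

  id-mono : ∀ {A} → Mono (id {A})
  id-mono g k p = let open IsEquivalence ≈-equiv in
    trans (sym identityˡ) (trans p identityˡ)

  ⊤S : ∀ {A} → Sub A
  ⊤S {A} = sub A id id-mono

  _∧S_ : ∀ {A} → Sub A → Sub A → Sub A
  S ∧S T = im (arr S ∘ Pullback.p₁ (pullback (arr S) (arr T)))

  _⁻¹[_] : ∀ {A B} → A ⇒ B → Sub B → Sub A
  f ⁻¹[ S ] = im (Pullback.p₁ (pullback f (arr S)))

  -- ∃_f : image of a subobject along f (left adjoint of f⁻¹)
  ∃[_]_ : ∀ {A B} → A ⇒ B → Sub A → Sub B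
  ∃[ f ] S = im (f ∘ arr S)

  record IsFilter {ℓ} {A : Obj} (G : Sub A → Set ℓ) : Set (o ⊔ h ⊔ e ⊔ ℓ) where
    field
      has-⊤ : G ⊤S
      up-closed : ∀ {S T} → S ≤ T → G S → G T
      ∧-closed : ∀ {S T} → G S → G T → G (S ∧S T)

record Signature : Set₁ where
  field
    Sort : Set
    Fun : Set
    funDom : Fun → List Sort
    funCod : Fun → Sort
    Rel : Set
    relDom : Rel → List Sort

module Syntax (Σ : Signature) (Var : Set) (_≟_ : DecidableEquality Var)
              (T : Var → Signature.Sort Σ) where
  open Signature Σ

  mutual
    data Term : Sort → Set where
      var : (x : Var) → Term (T x)
      app : (f : Fun) → Args (funDom f) → Term (funCod f)

    data Args : List Sort → Set where
      []  : Args []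
      _∷_ : ∀ {s ss} → Term s → Args ss → Args (s ∷ ss)

  data Formula : Set where
    ⊤ᶠ   : Formula
    _∧ᶠ_ : Formula → Formula → Formula
    eqᶠ  : ∀ {s} → Term s → Term s → Formula
    relᶠ : (R : Rel) → Args (relDom R) → Formula
    ∃ᶠ   : Var → Formula → Formula

  remove : Var → List Var → List Var
  remove y = filter (λ v → ¬? (v ≟ y))

  mutual
    fvt : ∀ {s} → Term s → List Var
    fvt (var x) = x ∷ []
    fvt (app f as) = fvs as

    fvs : ∀ {ss} → Args ss → List Var
    fvs [] = []
    fvs (t ∷ as) = fvt t ++ fvs as

  fv : Formula → List Var
  fv ⊤ᶠ = []
  fv (φ ∧ᶠ ψ) = fv φ ++ fv ψ
  fv (eqᶠ t u) = fvt t ++ fvt u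
  fv (relᶠ R as) = fvs as
  fv (∃ᶠ y φ) = remove y (fv φ)

  _∈Φ_ : Formula → List Var → Set
  φ ∈Φ U = fv φ ⊆ U

  FSet : Set₁
  FSet = Pred Formula 0ℓ

  _∣_ : FSet → List Var → FSet
  (Γ ∣ U) ψ = Γ ψ × ψ ∈Φ U

  _∪_ : FSet → FSet → FSet
  (Γ ∪ Δ) ψ = Γ ψ ⊎ Δ ψ

  ｛_｝ : Formula → FSet
  ｛ φ ｝ ψ = ψ ≡ φ

  remove-⊆ : ∀ y W → remove y W ⊆ W
  remove-⊆ y W p = proj₁ (∈-filter⁻ (λ v → ¬? (v ≟ y)) p)

  ∃-ctx : ∀ y φ W → fv (∃ᶠ y φ) ⊆ W → fv φ ⊆ (y ∷ remove y W)
  ∃-ctx y φ W sub {v} p with v ≟ y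
  ... | yes refl = here refl
  ... | no v≢y = there (∈-filter⁺ (λ v → ¬? (v ≟ y))
                   (sub (∈-filter⁺ (λ v → ¬? (v ≟ y)) p v≢y)) v≢y)

-- Simplicial complexes on X ⊆ Var; finite subsets are represented by
-- duplicate-free lists.

record SimplicialComplex (Var : Set) (X : Pred Var 0ℓ) : Set₁ where
  field
    C : Pred (List Var) 0ℓ
    C-unique : ∀ {U} → C U → Unique U
    C-⊆X : ∀ {U} → C U → ∀ {x} → x ∈ U → X x
    C-down : ∀ {U V} → C V → Unique U → U ⊆ V → C U
    C-covers : ∀ {x} → X x → Σ[ U ∈ List Var ] C U × x ∈ U

module Inchworm (Σ : Signature) (Var : Set) (_≟_ : DecidableEquality Var)
                (T : Var → Signature.Sort Σ) (X : Pred Var 0ℓ)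
                (𝒦 : SimplicialComplex Var X)
                (_⊢_ : Syntax.FSet Σ Var _≟_ T → Syntax.Formula Σ Var _≟_ T → Set) where
  open Syntax Σ Var _≟_ T
  open SimplicialComplex 𝒦

  infix 3 _⊢C_
  data _⊢C_ : FSet → Formula → Set₁ where
    base : ∀ {Γ φ} (U : List Var) → C U → φ ∈Φ U → (Γ ∣ U) ⊢ φ → Γ ⊢C φ
    -- (ii), with set equalities made explicit:  Γ = Γ₁ ∪ Δ,  Δ₁ = Δ ∪ {φ}
    cut : ∀ {Γ Γ₁ Δ Δ₁ φ ψ} → Γ₁ ⊢C φ → Δ₁ ⊢C ψ →
          Δ₁ ≐ (Δ ∪ ｛ φ ｝) → Γ ≐ (Γ₁ ∪ Δ) → Γ ⊢C ψ

module Semantics {o h e : Level} (𝐒 : RegularCategory o h e)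
                 (Σ : Signature) (Var : Set) (_≟_ : DecidableEquality Var)
                 (T : Var → Signature.Sort Σ) where
  open RegularCategory 𝐒
  open Subobjects 𝐒
  open Signature Σ
  open Syntax Σ Var _≟_ T

  record Interpretation : Set (o ⊔ h ⊔ e) where
    field
      ⟦_⟧ˢ : Sort → Obj
      ⟦_⟧ᶠ : (f : Fun) → prod (funDom f) ⟦_⟧ˢ ⇒ ⟦ funCod f ⟧ˢ
      ⟦_⟧ʳ : (R : Rel) → Sub (prod (relDom R) ⟦_⟧ˢ)

  module Interpret (I : Interpretation) where
    open Interpretation I

    F : List Var → Obj
    F U = prod U (λ x → ⟦ T x ⟧ˢ)

    F⊆ : ∀ {U V} → U ⊆ V → F V ⇒ F U
    F⊆ s = ⟨ (λ p → proj (s p)) ⟩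

    mutual
      ⟦_⟧t : ∀ {s} (t : Term s) {W} → fvt t ⊆ W → F W ⇒ ⟦ s ⟧ˢ
      ⟦ var x ⟧t w = proj (w (here refl))
      ⟦ app f as ⟧t w = ⟦ f ⟧ᶠ ∘ ⟨ ⟦ as ⟧a w ⟩

      ⟦_⟧a : ∀ {ss} (as : Args ss) {W} → fvs as ⊆ W →
             ∀ {s} → s ∈ ss → F W ⇒ ⟦ s ⟧ˢ
      ⟦ t ∷ as ⟧a w (here refl) = ⟦ t ⟧t (λ p → w (∈-++⁺ˡ p))
      ⟦ _∷_ t as ⟧a w (there p) = ⟦ as ⟧a (λ q → w (∈-++⁺ʳ (fvt t) q)) p

    ⟦_⟧ : (φ : Formula) (W : List Var) → φ ∈Φ W → Sub (F W)
    ⟦ ⊤ᶠ ⟧ W w = ⊤S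
    ⟦ φ ∧ᶠ ψ ⟧ W w = ⟦ φ ⟧ W (λ p → w (∈-++⁺ˡ p)) ∧S ⟦ ψ ⟧ W (λ p → w (∈-++⁺ʳ (fv φ) p))
    ⟦ eqᶠ t u ⟧ W w =
      im (Equalizer.eq (equalizer (⟦ t ⟧t (λ p → w (∈-++⁺ˡ p)))
                                  (⟦ u ⟧t (λ p → w (∈-++⁺ʳ (fvt t) p)))))
    ⟦ relᶠ R as ⟧ W w = ⟨ ⟦ as ⟧a w ⟩ ⁻¹[ ⟦ R ⟧ʳ ]
    ⟦ ∃ᶠ y φ ⟧ W w =
      F⊆ (remove-⊆ y W) ⁻¹[ ∃[ F⊆ {remove y W} {y ∷ remove y W} there ]
                              ⟦ φ ⟧ (y ∷ remove y W) (∃-ctx y φ W w) ]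

    ⋀ : (Δ : List Formula) (U : List Var) → All (λ ψ → ψ ∈Φ U) Δ → Sub (F U)
    ⋀ [] U [] = ⊤S
    ⋀ (ψ ∷ Δ) U (w ∷ ws) = ⟦ ψ ⟧ U w ∧S ⋀ Δ U ws

    inΦ : (Γ : FSet) (U : List Var) → (∀ ψ → Γ ψ → ψ ∈Φ U) →
          ∀ {Δ} → All Γ Δ → All (λ ψ → ψ ∈Φ U) Δ
    inΦ Γ U ΓU [] = []
    inΦ Γ U ΓU (_∷_ {ψ} γ γs) = ΓU ψ γ ∷ inΦ Γ U ΓU γs

    Conservative : (FSet → Formula → Set) → Set (lsuc 0ℓ ⊔ h ⊔ e)
    Conservative _⊢_ =
      ∀ (Γ : FSet) (φ : Formula) (U : List Var) → Unique U →
        (ΓU : ∀ ψ → Γ ψ → ψ ∈Φ U) (φU : φ ∈Φ U) →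
        ((Σ[ Δ ∈ List Formula ] Σ[ ΔΓ ∈ All Γ Δ ]
            (⋀ Δ U (inΦ Γ U ΓU ΔΓ) ≤ ⟦ φ ⟧ U φU))
          → Γ ⊢ φ)
        × (Γ ⊢ φ →
          Σ[ Δ ∈ List Formula ] Σ[ ΔΓ ∈ All Γ Δ ]
            (⋀ Δ U (inΦ Γ U ΓU ΔΓ) ≤ ⟦ φ ⟧ U φU))

    module FilterModels {X : Pred Var 0ℓ} (𝒦 : SimplicialComplex Var X) where
      open SimplicialComplex 𝒦

      record IsFilterModel {ℓ} (G : (U : List Var) → Sub (F U) → Set ℓ)
             : Set (o ⊔ h ⊔ e ⊔ ℓ) where
        field
          isFilter : ∀ {U} → C U → IsFilter (G U)
          restrict-⁻¹ : ∀ {U V} → C U → C V → (s : U ⊆ V) → ∀ S →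
            (G U S → G V (F⊆ s ⁻¹[ S ])) × (G V (F⊆ s ⁻¹[ S ]) → G U S)
          restrict-∃ : ∀ {U V} → C U → C V → (s : U ⊆ V) → ∀ S →
            (G U S → Σ[ S' ∈ Sub (F V) ] G V S' × (S ≅ ∃[ F⊆ s ] S'))
            × (Σ[ S' ∈ Sub (F V) ] G V S' × (S ≅ ∃[ F⊆ s ] S') → G U S)

      _⊨_ : ∀ {ℓ} → ((U : List Var) → Sub (F U) → Set ℓ) → Formula → Set ℓ
      G ⊨ φ = ∀ U → C U → (w : φ ∈Φ U) → G U (⟦ φ ⟧ U w)

      _⊨Γ_ : ∀ {ℓ} → ((U : List Var) → Sub (F U) → Set ℓ) → FSet → Set ℓ
      G ⊨Γ Γ = ∀ ψ → Γ ψ → G ⊨ ψ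

      InΦC : Formula → Set
      InΦC φ = Σ[ U ∈ List Var ] C U × φ ∈Φ U

module Submission where

open import Defs
open import Level using (Level; _⊔_; 0ℓ; Lift; lift) renaming (suc to lsuc)
import Level
open import Axiom.UniquenessOfIdentityProofs using (module Decidable⇒UIP)
open import Data.Empty using (⊥-elim)
open import Data.Product using (Σ-syntax; _×_; _,_; proj₁; proj₂)
open import Data.Sum using (_⊎_; inj₁; inj₂)
open import Data.List using (List; []; _∷_; filter)
open import Data.List.Membership.Propositional using (_∈_)
open import Data.List.Membership.Propositional.Properties using (∈-filter⁺; ∈-filter⁻; ∈-++⁺ˡ; ∈-++⁺ʳ; ∈-++⁻)
import Data.List.Membership.DecPropositional as DecMembership
open import Data.List.Membership.Setoid.Properties using (unique⇒irrelevant)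
open import Data.List.Relation.Unary.All using (All; []; _∷_; lookup)
open import Data.List.Relation.Unary.All.Properties.Core using (¬Any⇒All¬)
import Data.List.Relation.Unary.AllPairs as AllPairs
open import Data.List.Relation.Unary.AllPairs.Core using (_∷_)
open import Data.List.Relation.Unary.Any using (here; there)
open import Data.List.Relation.Unary.Unique.Propositional using (Unique)
open import Data.List.Relation.Unary.Unique.Propositional.Properties using (filter⁺)
open import Data.List.Relation.Binary.Subset.Propositional using (_⊆_)
open import Relation.Binary using (IsEquivalence; DecidableEquality)
open import Relation.Binary.PropositionalEquality using (_≡_; refl; cong; setoid)
open import Relation.Nullary using (¬_; ¬?; yes; no)
open import Relation.Unary using (Pred; ∅)

-- Soundness: a base step Γ_U ⊢ φ yields, by conservativity, a finite meet of interpretations of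
-- members of Γ below ⟦φ⟧_U, which lies in the filter G_U; the two restriction conditions move ⟦φ⟧
-- from U to any other face containing its free variables through their intersection, and cuts compose.
-- Completeness: the subobjects lying above ⟦ψ⟧_U for some ⊢_C-consequence ψ of Γ form a filter model
-- of Γ. Restriction from a face V to a face U ⊆ V is mirrored syntactically by ψ ↦ ∃(V∖U). ψ, whose
-- interpretation lies below the image of ⟦ψ⟧_V. Conservativity also makes the projections F_V → F_U
-- onto, and Beck–Chevalley then gives S ≤ ∃(F⁻¹ S), the remaining restriction condition. A formula
-- true in this model lies above some ⟦ψ⟧_U, hence is derivable from ψ and so from Γ.

module SubobjectCalculus {o h e : Level} (𝐒 : RegularCategory o h e) where
  open RegularCategory 𝐒
  open Subobjects 𝐒

  private module ≈ {A B : Obj} = IsEquivalence (≈-equiv {A} {B})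

  ≈-refl : ∀ {A B} {f : A ⇒ B} → f ≈ f
  ≈-refl = ≈.refl

  ⟺ : ∀ {A B} {f g : A ⇒ B} → f ≈ g → g ≈ f
  ⟺ = ≈.sym

  infixr 4 _○_
  _○_ : ∀ {A B} {f g k : A ⇒ B} → f ≈ g → g ≈ k → f ≈ k
  _○_ = ≈.trans

  ∘-resp-≈ˡ : ∀ {A B C} {f f' : B ⇒ C} {g : A ⇒ B} → f ≈ f' → f ∘ g ≈ f' ∘ g
  ∘-resp-≈ˡ p = ∘-resp-≈ p ≈-refl

  ∘-resp-≈ʳ : ∀ {A B C} {f : B ⇒ C} {g g' : A ⇒ B} → g ≈ g' → f ∘ g ≈ f ∘ g'
  ∘-resp-≈ʳ p = ∘-resp-≈ ≈-refl p

  sym-assoc : ∀ {A B C D} {f : A ⇒ B} {g : B ⇒ C} {k : C ⇒ D} → k ∘ (g ∘ f) ≈ (k ∘ g) ∘ f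
  sym-assoc = ⟺ assoc

  regularEpi⇒epi : ∀ {B Q} {c : B ⇒ Q} → RegularEpi c →
                   ∀ {R} (u v : Q ⇒ R) → u ∘ c ≈ v ∘ c → u ≈ v
  regularEpi⇒epi {c = c} (_ , _ , _ , cf≈cg , universal) u v uc≈vc =
    unique u ≈-refl ○ ⟺ (unique v (⟺ uc≈vc))
    where
    unique = proj₂ (proj₂ (universal (u ∘ c) (assoc ○ ∘-resp-≈ʳ cf≈cg ○ sym-assoc)))

  regularEpi-mono-diagonal : ∀ {A B C D} {q : A ⇒ B} {n : C ⇒ D} (u : B ⇒ D) (v : A ⇒ C) →
                      RegularEpi q → Mono n → u ∘ q ≈ n ∘ v → Σ[ d ∈ B ⇒ C ] (n ∘ d ≈ u)
  regularEpi-mono-diagonal {q = q} {n} u v q-reg@(_ , f , g , qf≈qg , universal) n-mono uq≈nv =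
    proj₁ r , regularEpi⇒epi q-reg (n ∘ proj₁ r) u (assoc ○ ∘-resp-≈ʳ (proj₁ (proj₂ r)) ○ ⟺ uq≈nv)
    where
    vf≈vg = n-mono (v ∘ f) (v ∘ g)
      (sym-assoc ○ ∘-resp-≈ˡ (⟺ uq≈nv) ○ assoc ○ ∘-resp-≈ʳ qf≈qg ○ sym-assoc ○ ∘-resp-≈ˡ uq≈nv ○ assoc)
    r = universal v vf≈vg

  infix 4 _∈ₛ_
  record _∈ₛ_ {B A} (g : B ⇒ A) (S : Sub A) : Set (h ⊔ e) where
    constructor _,_
    field
      factor : B ⇒ dom S
      factor-commutes : arr S ∘ factor ≈ g
  open _∈ₛ_ public

  ∈ₛ-∘ : ∀ {B C A} {g : B ⇒ A} {S : Sub A} (x : C ⇒ B) → g ∈ₛ S → g ∘ x ∈ₛ S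
  ∈ₛ-∘ x (k , p) = k ∘ x , sym-assoc ○ ∘-resp-≈ˡ p

  ∈ₛ-resp-≈ : ∀ {B A} {g g' : B ⇒ A} {S : Sub A} → g ≈ g' → g ∈ₛ S → g' ∈ₛ S
  ∈ₛ-resp-≈ q (k , p) = k , p ○ q

  arr∈ₛ : ∀ {A} (S : Sub A) → arr S ∈ₛ S
  arr∈ₛ S = id , identityʳ

  ∈ₛ-⊤ : ∀ {B A} (g : B ⇒ A) → g ∈ₛ ⊤S
  ∈ₛ-⊤ g = g , identityˡ

  ∈ₛ-im : ∀ {B A} (f : B ⇒ A) → f ∈ₛ im f
  ∈ₛ-im f = Factorization.q (factorize f) , Factorization.factors (factorize f)

  -- _≤_ wrapped in a record so that both subobjects can be inferred from the type.
  infix 4 _⊑_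
  record _⊑_ {A} (S T : Sub A) : Set (h ⊔ e) where
    constructor ⊑-intro
    field
      arr∈ₛ-⊑ : arr S ∈ₛ T
  open _⊑_ public

  ⊑⇒≤ : ∀ {A} {S T : Sub A} → S ⊑ T → S ≤ T
  ⊑⇒≤ (⊑-intro (k , p)) = k , p

  ≤⇒⊑ : ∀ {A} {S T : Sub A} → S ≤ T → S ⊑ T
  ≤⇒⊑ (k , p) = ⊑-intro (k , p)

  ∈ₛ-⊑ : ∀ {B A} {g : B ⇒ A} {S T : Sub A} → g ∈ₛ S → S ⊑ T → g ∈ₛ T
  ∈ₛ-⊑ (k , p) (⊑-intro (k' , p')) = k' ∘ k , sym-assoc ○ ∘-resp-≈ˡ p' ○ p

  ⊑-refl : ∀ {A} {S : Sub A} → S ⊑ S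
  ⊑-refl {S = S} = ⊑-intro (arr∈ₛ S)

  ⊑-trans : ∀ {A} {S T R : Sub A} → S ⊑ T → T ⊑ R → S ⊑ R
  ⊑-trans (⊑-intro p) q = ⊑-intro (∈ₛ-⊑ p q)

  im-elim : ∀ {B B' A C} {g : B ⇒ A} {f : B' ⇒ A} {T : Sub C} (x : A ⇒ C) →
            g ∈ₛ im f → x ∘ f ∈ₛ T → x ∘ g ∈ₛ T
  im-elim {g = g} {f} {T} x (k , gk) (j , fj) =
    proj₁ fill ∘ k , sym-assoc ○ ∘-resp-≈ˡ (proj₂ fill) ○ assoc ○ ∘-resp-≈ʳ gk
    where
    open Factorization (factorize f)
    fill = regularEpi-mono-diagonal (x ∘ m) j q-regEpi (mono T) (assoc ○ ∘-resp-≈ʳ factors ○ ⟺ fj)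

  im-least : ∀ {B A} {f : B ⇒ A} {T : Sub A} → f ∈ₛ T → im f ⊑ T
  im-least {f = f} f∈T = ⊑-intro (∈ₛ-resp-≈ identityˡ
    (im-elim id (arr∈ₛ (im f)) (∈ₛ-resp-≈ (⟺ identityˡ) f∈T)))

  ∈ₛ-⁻¹⁻ : ∀ {B C A} {g : B ⇒ C} {f : C ⇒ A} {S : Sub A} → g ∈ₛ f ⁻¹[ S ] → f ∘ g ∈ₛ S
  ∈ₛ-⁻¹⁻ {f = f} {S} g∈ = im-elim f g∈ (p₂ , ⟺ (proj₁ isPullback))
    where open Pullback (pullback f (arr S))

  ∈ₛ-⁻¹⁺ : ∀ {B C A} {g : B ⇒ C} {f : C ⇒ A} {S : Sub A} → f ∘ g ∈ₛ S → g ∈ₛ f ⁻¹[ S ]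
  ∈ₛ-⁻¹⁺ {g = g} {f} {S} (k , p) =
    ∈ₛ-resp-≈ (proj₁ (proj₁ (proj₂ r))) (∈ₛ-∘ (proj₁ r) (∈ₛ-im p₁))
    where
    open Pullback (pullback f (arr S))
    r = proj₂ isPullback g k (⟺ p)

  ∈ₛ-∃ : ∀ {B C A} {g : B ⇒ C} {f : C ⇒ A} {S : Sub C} → g ∈ₛ S → f ∘ g ∈ₛ ∃[ f ] S
  ∈ₛ-∃ {f = f} {S} (k , p) = ∈ₛ-resp-≈ (assoc ○ ∘-resp-≈ʳ p) (∈ₛ-∘ k (∈ₛ-im (f ∘ arr S)))

  ∃-least : ∀ {C A} {f : C ⇒ A} {S : Sub C} {T : Sub A} → f ∘ arr S ∈ₛ T → ∃[ f ] S ⊑ T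
  ∃-least = im-least

  ∈ₛ-∧⁻ : ∀ {B A} {g : B ⇒ A} {S T : Sub A} → g ∈ₛ S ∧S T → g ∈ₛ S × g ∈ₛ T
  ∈ₛ-∧⁻ {S = S} {T} g∈ =
      ∈ₛ-resp-≈ identityˡ (im-elim id g∈ (∈ₛ-resp-≈ (⟺ identityˡ) (p₁ , ≈-refl)))
    , ∈ₛ-resp-≈ identityˡ (im-elim id g∈ (∈ₛ-resp-≈ (⟺ (proj₁ isPullback) ○ ⟺ identityˡ) (p₂ , ≈-refl)))
    where open Pullback (pullback (arr S) (arr T))

  ∈ₛ-∧⁺ : ∀ {B A} {g : B ⇒ A} {S T : Sub A} → g ∈ₛ S → g ∈ₛ T → g ∈ₛ S ∧S T
  ∈ₛ-∧⁺ {S = S} {T} (a , pa) (b , pb) =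
    ∈ₛ-resp-≈ (assoc ○ ∘-resp-≈ʳ (proj₁ (proj₁ (proj₂ r))) ○ pa) (∈ₛ-∘ (proj₁ r) (∈ₛ-im (arr S ∘ p₁)))
    where
    open Pullback (pullback (arr S) (arr T))
    r = proj₂ isPullback a b (pa ○ ⟺ pb)

  ∈ₛ-equalizer⁻ : ∀ {B A C} {t u : A ⇒ C} {g : B ⇒ A} →
                  g ∈ₛ im (Equalizer.eq (equalizer t u)) → t ∘ g ≈ u ∘ g
  ∈ₛ-equalizer⁻ {t = t} {u} (k , p) =
    ∘-resp-≈ʳ (⟺ p) ○ sym-assoc ○ ∘-resp-≈ˡ tm≈um ○ assoc ○ ∘-resp-≈ʳ p
    where
    open Equalizer (equalizer t u)
    open Factorization (factorize eq)
    tm≈um = regularEpi⇒epi q-regEpi (t ∘ m) (u ∘ m)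
      (assoc ○ ∘-resp-≈ʳ factors ○ proj₁ isEqualizer ○ ∘-resp-≈ʳ (⟺ factors) ○ sym-assoc)

  ∈ₛ-equalizer⁺ : ∀ {B A C} {t u : A ⇒ C} {g : B ⇒ A} →
                  t ∘ g ≈ u ∘ g → g ∈ₛ im (Equalizer.eq (equalizer t u))
  ∈ₛ-equalizer⁺ {t = t} {u} {g} p = ∈ₛ-resp-≈ (proj₁ (proj₂ r)) (∈ₛ-∘ (proj₁ r) (∈ₛ-im eq))
    where
    open Equalizer (equalizer t u)
    r = proj₂ isEqualizer g p

  infix 4 _≃_
  record _≃_ {A} (S T : Sub A) : Set (h ⊔ e) where
    constructor ≃-intro
    field
      ≃⇒⊑ : S ⊑ T
      ≃⇒⊒ : T ⊑ S
  open _≃_ public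

  ≃-from-∈ₛ : ∀ {A} {S T : Sub A} →
              (∀ {B} (g : B ⇒ A) → g ∈ₛ S → g ∈ₛ T) → (∀ {B} (g : B ⇒ A) → g ∈ₛ T → g ∈ₛ S) → S ≃ T
  ≃-from-∈ₛ {S = S} {T} to from = ≃-intro (⊑-intro (to _ (arr∈ₛ S))) (⊑-intro (from _ (arr∈ₛ T)))

  ≃-sym : ∀ {A} {S T : Sub A} → S ≃ T → T ≃ S
  ≃-sym (≃-intro p q) = ≃-intro q p

  ≃-trans : ∀ {A} {S T R : Sub A} → S ≃ T → T ≃ R → S ≃ R
  ≃-trans (≃-intro p q) (≃-intro p' q') = ≃-intro (⊑-trans p p') (⊑-trans q' q)

  ⁻¹-mono : ∀ {C A} {f : C ⇒ A} {S T : Sub A} → S ⊑ T → f ⁻¹[ S ] ⊑ f ⁻¹[ T ]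
  ⁻¹-mono {f = f} S⊑T = ⊑-intro (∈ₛ-⁻¹⁺ (∈ₛ-⊑ (∈ₛ-⁻¹⁻ {f = f} (arr∈ₛ _)) S⊑T))

  ∃-mono : ∀ {C A} {f : C ⇒ A} {S T : Sub C} → S ⊑ T → ∃[ f ] S ⊑ ∃[ f ] T
  ∃-mono {f = f} {S} (⊑-intro S∈T) = ∃-least {f = f} {S = S} (∈ₛ-∃ S∈T)

  ⁻¹-cong : ∀ {C A} {f : C ⇒ A} {S T : Sub A} → S ≃ T → f ⁻¹[ S ] ≃ f ⁻¹[ T ]
  ⁻¹-cong (≃-intro p q) = ≃-intro (⁻¹-mono p) (⁻¹-mono q)

  ∃-cong : ∀ {C A} {f : C ⇒ A} {S T : Sub C} → S ≃ T → ∃[ f ] S ≃ ∃[ f ] T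
  ∃-cong (≃-intro p q) = ≃-intro (∃-mono p) (∃-mono q)

  ∃⊣⁻¹-counit : ∀ {C A} {f : C ⇒ A} {S : Sub A} → ∃[ f ] (f ⁻¹[ S ]) ⊑ S
  ∃⊣⁻¹-counit {f = f} {S} = ∃-least {f = f} {S = f ⁻¹[ S ]} (∈ₛ-⁻¹⁻ (arr∈ₛ _))

  ∃-∘ : ∀ {B C A} {f : C ⇒ A} {g : B ⇒ C} {S : Sub B} → ∃[ f ] (∃[ g ] S) ⊑ ∃[ f ∘ g ] S
  ∃-∘ {f = f} {g} {S} = ∃-least {f = f} {S = ∃[ g ] S}
    (im-elim f (arr∈ₛ (∃[ g ] S)) (∈ₛ-resp-≈ assoc (∈ₛ-im ((f ∘ g) ∘ arr S))))

  ∃-resp-≈ : ∀ {C A} {f f' : C ⇒ A} {S : Sub C} → f ≈ f' → ∃[ f ] S ⊑ ∃[ f' ] S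
  ∃-resp-≈ {f = f} {S = S} p = ∃-least {f = f} {S = S} (∈ₛ-resp-≈ (∘-resp-≈ˡ (⟺ p)) (∈ₛ-im _))

  id⁻¹ : ∀ {A} (S : Sub A) → id ⁻¹[ S ] ≃ S
  id⁻¹ S = ≃-from-∈ₛ (λ g g∈ → ∈ₛ-resp-≈ identityˡ (∈ₛ-⁻¹⁻ {f = id} g∈))
                     (λ g g∈ → ∈ₛ-⁻¹⁺ (∈ₛ-resp-≈ (⟺ identityˡ) g∈))

  ∧-⊤-⊑ : ∀ {A} {S : Sub A} → S ∧S ⊤S ⊑ S
  ∧-⊤-⊑ {S = S} = ⊑-intro (proj₁ (∈ₛ-∧⁻ {T = ⊤S} (arr∈ₛ (S ∧S ⊤S))))

  ⁻¹-⊤ : ∀ {C A} {f : C ⇒ A} → ⊤S ≃ f ⁻¹[ ⊤S ]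
  ⁻¹-⊤ = ≃-from-∈ₛ (λ g _ → ∈ₛ-⁻¹⁺ (∈ₛ-⊤ _)) (λ g _ → ∈ₛ-⊤ g)

  ∧-mono : ∀ {A} {S S' T T' : Sub A} → S ⊑ S' → T ⊑ T' → S ∧S T ⊑ S' ∧S T'
  ∧-mono {S = S} {T = T} S⊑S' T⊑T' = ⊑-intro
    (let (S∧T∈S , S∧T∈T) = ∈ₛ-∧⁻ (arr∈ₛ (S ∧S T)) in ∈ₛ-∧⁺ (∈ₛ-⊑ S∧T∈S S⊑S') (∈ₛ-⊑ S∧T∈T T⊑T'))

  ∧-cong : ∀ {A} {S S' T T' : Sub A} → S ≃ S' → T ≃ T' → S ∧S T ≃ S' ∧S T'
  ∧-cong S≃S' T≃T' = ≃-intro (∧-mono (≃⇒⊑ S≃S') (≃⇒⊑ T≃T')) (∧-mono (≃⇒⊒ S≃S') (≃⇒⊒ T≃T'))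

  ⁻¹-∧ : ∀ {C A} {f : C ⇒ A} {S T : Sub A} → f ⁻¹[ S ∧S T ] ≃ (f ⁻¹[ S ]) ∧S (f ⁻¹[ T ])
  ⁻¹-∧ {f = f} {S} {T} = ≃-from-∈ₛ
    (λ g g∈ → let (g∈S , g∈T) = ∈ₛ-∧⁻ {S = S} {T = T} (∈ₛ-⁻¹⁻ {f = f} g∈) in
      ∈ₛ-∧⁺ (∈ₛ-⁻¹⁺ {f = f} g∈S) (∈ₛ-⁻¹⁺ {f = f} g∈T))
    (λ g g∈ → let (g∈S , g∈T) = ∈ₛ-∧⁻ g∈ in
      ∈ₛ-⁻¹⁺ (∈ₛ-∧⁺ (∈ₛ-⁻¹⁻ {f = f} {S = S} g∈S) (∈ₛ-⁻¹⁻ {f = f} {S = T} g∈T)))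

  ⁻¹-∘ : ∀ {B C A} {f : C ⇒ A} {g : B ⇒ C} {S : Sub A} → (f ∘ g) ⁻¹[ S ] ≃ g ⁻¹[ f ⁻¹[ S ] ]
  ⁻¹-∘ {f = f} {g} {S} = ≃-from-∈ₛ
    (λ x x∈ → ∈ₛ-⁻¹⁺ {f = g} (∈ₛ-⁻¹⁺ {f = f} {S = S} (∈ₛ-resp-≈ assoc (∈ₛ-⁻¹⁻ {f = f ∘ g} x∈))))
    (λ x x∈ → ∈ₛ-⁻¹⁺ {f = f ∘ g}
      (∈ₛ-resp-≈ sym-assoc (∈ₛ-⁻¹⁻ {f = f} {S = S} (∈ₛ-⁻¹⁻ {f = g} {S = f ⁻¹[ S ]} x∈))))

  ⁻¹-resp-≈ : ∀ {C A} {f f' : C ⇒ A} {S : Sub A} → f ≈ f' → f ⁻¹[ S ] ≃ f' ⁻¹[ S ]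
  ⁻¹-resp-≈ {f = f} {f'} {S} p = ≃-from-∈ₛ
    (λ g g∈ → ∈ₛ-⁻¹⁺ {f = f'} {S = S} (∈ₛ-resp-≈ (∘-resp-≈ˡ p) (∈ₛ-⁻¹⁻ {f = f} g∈)))
    (λ g g∈ → ∈ₛ-⁻¹⁺ {f = f} {S = S} (∈ₛ-resp-≈ (∘-resp-≈ˡ (⟺ p)) (∈ₛ-⁻¹⁻ {f = f'} g∈)))

  equalizerₛ : ∀ {A B} → A ⇒ B → A ⇒ B → Sub A
  equalizerₛ t u = im (Equalizer.eq (equalizer t u))

  equalizerₛ-resp-≈ : ∀ {A B} {t t' u u' : A ⇒ B} → t ≈ t' → u ≈ u' → equalizerₛ t u ≃ equalizerₛ t' u'
  equalizerₛ-resp-≈ t≈t' u≈u' = ≃-from-∈ₛ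
    (λ g g∈ → ∈ₛ-equalizer⁺ (∘-resp-≈ˡ (⟺ t≈t') ○ ∈ₛ-equalizer⁻ g∈ ○ ∘-resp-≈ˡ u≈u'))
    (λ g g∈ → ∈ₛ-equalizer⁺ (∘-resp-≈ˡ t≈t' ○ ∈ₛ-equalizer⁻ g∈ ○ ∘-resp-≈ˡ (⟺ u≈u')))

  equalizerₛ-⁻¹ : ∀ {C A B} {f : C ⇒ A} {t u : A ⇒ B} → f ⁻¹[ equalizerₛ t u ] ≃ equalizerₛ (t ∘ f) (u ∘ f)
  equalizerₛ-⁻¹ {f = f} {t} {u} = ≃-from-∈ₛ
    (λ g g∈ → ∈ₛ-equalizer⁺ (assoc ○ ∈ₛ-equalizer⁻ (∈ₛ-⁻¹⁻ {f = f} {S = equalizerₛ t u} g∈) ○ sym-assoc))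
    (λ g g∈ → ∈ₛ-⁻¹⁺ {f = f} (∈ₛ-equalizer⁺ (sym-assoc ○ ∈ₛ-equalizer⁻ g∈ ○ assoc)))

  module BeckChevalley {A B B' A'} (p : A ⇒ B) (k : B' ⇒ B) (p' : A' ⇒ B') (k' : A' ⇒ A)
           (commutes : k ∘ p' ≈ p ∘ k')
           (weakPullback : ∀ {Q} (a : Q ⇒ B') (b : Q ⇒ A) → k ∘ a ≈ p ∘ b →
                           Σ[ u ∈ Q ⇒ A' ] (p' ∘ u ≈ a) × (k' ∘ u ≈ b)) where

    beckChevalley-⊒ : ∀ (S : Sub A) → ∃[ p' ] (k' ⁻¹[ S ]) ⊑ k ⁻¹[ ∃[ p ] S ]
    beckChevalley-⊒ S = ∃-least {f = p'} {S = k' ⁻¹[ S ]}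
      (∈ₛ-⁻¹⁺ (∈ₛ-resp-≈ (sym-assoc ○ ∘-resp-≈ˡ (⟺ commutes) ○ assoc)
      (∈ₛ-∃ {f = p} (∈ₛ-⁻¹⁻ {f = k'} {S = S} (arr∈ₛ (k' ⁻¹[ S ]))))))

    -- Pull the regular epi of the image of p ∘ S back along k; it covers R, and its
    -- domain maps into the weak pullback, i.e. into ∃[ p' ] (k' ⁻¹[ S ]).
    beckChevalley-⊑ : ∀ (S : Sub A) → k ⁻¹[ ∃[ p ] S ] ⊑ ∃[ p' ] (k' ⁻¹[ S ])
    beckChevalley-⊑ S = ⊑-intro (proj₁ fill , proj₂ fill)
      where
      open Factorization (factorize (p ∘ arr S))
      R = k ⁻¹[ ∃[ p ] S ]
      R∈ = ∈ₛ-⁻¹⁻ {f = k} {S = ∃[ p ] S} (arr∈ₛ R)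
      open Pullback (pullback (factor R∈) q) renaming (p₁ to a; p₂ to b)
      a-regEpi = regEpi-pullback-stable (factor R∈) q a b q-regEpi isPullback
      w = weakPullback (arr R ∘ a) (arr S ∘ b)
            (sym-assoc ○ ∘-resp-≈ˡ (⟺ (factor-commutes R∈)) ○ assoc ○ ∘-resp-≈ʳ (proj₁ isPullback)
             ○ sym-assoc ○ ∘-resp-≈ˡ factors ○ assoc)
      Ra∈ : arr R ∘ a ∈ₛ ∃[ p' ] (k' ⁻¹[ S ])
      Ra∈ = ∈ₛ-resp-≈ (proj₁ (proj₂ w)) (∈ₛ-∃ (∈ₛ-⁻¹⁺ {f = k'} {S = S} (b , ⟺ (proj₂ (proj₂ w)))))
      fill = regularEpi-mono-diagonal (arr R) (factor Ra∈) a-regEpi (mono (∃[ p' ] (k' ⁻¹[ S ])))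
               (⟺ (factor-commutes Ra∈))

    beckChevalley : ∀ (S : Sub A) → k ⁻¹[ ∃[ p ] S ] ≃ ∃[ p' ] (k' ⁻¹[ S ])
    beckChevalley S = ≃-intro (beckChevalley-⊑ S) (beckChevalley-⊒ S)

  -- If f is onto (∃ f ⊤ = ⊤), so is its pullback along arr S; hence S is covered by f ⁻¹[ S ].
  onto⇒⊑∃⁻¹ : ∀ {C A} {f : C ⇒ A} → ⊤S ⊑ ∃[ f ] ⊤S → ∀ (S : Sub A) → S ⊑ ∃[ f ] (f ⁻¹[ S ])
  onto⇒⊑∃⁻¹ {f = f} f-onto S = ⊑-intro (∈ₛ-resp-≈ identityʳ (im-elim (arr S) p₂-onto S∘p₂∈))
    where
    open Pullback (pullback f (arr S))
    weakPullback : ∀ {Q} (a : Q ⇒ dom S) (b : Q ⇒ _) → arr S ∘ a ≈ f ∘ b →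
                   Σ[ u ∈ Q ⇒ P ] (p₂ ∘ u ≈ a) × (p₁ ∘ u ≈ b)
    weakPullback a b Sa≈fb = let r = proj₂ isPullback b a (⟺ Sa≈fb) in
      proj₁ r , proj₂ (proj₁ (proj₂ r)) , proj₁ (proj₁ (proj₂ r))
    open BeckChevalley f (arr S) p₂ p₁ (⟺ (proj₁ isPullback)) weakPullback
    ⊤P = p₁ ⁻¹[ ⊤S ]
    p₂-onto : id ∈ₛ im (p₂ ∘ arr ⊤P)
    p₂-onto = ∈ₛ-⊑ (∈ₛ-⁻¹⁺ {f = arr S} {S = ∃[ f ] ⊤S} (∈ₛ-⊑ (∈ₛ-⊤ (arr S ∘ id)) f-onto)) (beckChevalley-⊑ ⊤S)
    S∘p₂∈ : arr S ∘ (p₂ ∘ arr ⊤P) ∈ₛ ∃[ f ] (f ⁻¹[ S ])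
    S∘p₂∈ = ∈ₛ-resp-≈ (sym-assoc ○ ∘-resp-≈ˡ (proj₁ isPullback) ○ assoc)
      (∈ₛ-∃ {f = f} (∈ₛ-⁻¹⁺ {f = f} {S = S} (p₂ ∘ arr ⊤P , sym-assoc ○ ∘-resp-≈ˡ (⟺ (proj₁ isPullback)) ○ assoc)))

module Reindexing {o h e : Level} (𝐒 : RegularCategory o h e) (Sg : Signature) (Var : Set)
                  (_≟_ : DecidableEquality Var) (T : Var → Signature.Sort Sg)
                  (I : Semantics.Interpretation 𝐒 Sg Var _≟_ T) where
  open RegularCategory 𝐒
  open Subobjects 𝐒
  open SubobjectCalculus 𝐒
  open Syntax Sg Var _≟_ T
  open Semantics.Interpretation I
  open Semantics.Interpret 𝐒 Sg Var _≟_ T I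

  proj∘⟨⟩ : ∀ {J : Set} {W : List J} {G : J → Obj} {Q} (g : ∀ {x} → x ∈ W → Q ⇒ G x) {x} (p : x ∈ W) →
            proj p ∘ ⟨ g ⟩ ≈ g p
  proj∘⟨⟩ {W = W} {G} g = proj₁ (proj₂ (prod-isProduct W G g))

  prod-ext : ∀ {J : Set} {W : List J} {G : J → Obj} {Q} {u v : Q ⇒ prod W G} →
             (∀ {x} (p : x ∈ W) → proj p ∘ u ≈ proj p ∘ v) → u ≈ v
  prod-ext {W = W} {G} {u = u} {v} pu≈pv = unique u pu≈pv ○ ⟺ (unique v (λ _ → ≈-refl))
    where unique = proj₂ (proj₂ (prod-isProduct W G (λ p → proj p ∘ v)))

  π : ∀ {U : List Var} {x} → x ∈ U → F U ⇒ ⟦ T x ⟧ˢ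
  π {U} = proj {W = U} {F = λ x → ⟦ T x ⟧ˢ}

  π-cong : ∀ {U : List Var} {x} {p q : x ∈ U} → p ≡ q → π p ≈ π q
  π-cong refl = ≈-refl

  π∘F⊆ : ∀ {U V : List Var} (s : U ⊆ V) {x} (p : x ∈ U) → π p ∘ F⊆ s ≈ π (s p)
  π∘F⊆ s = proj∘⟨⟩ (λ q → proj (s q))

  F-ext : ∀ {U : List Var} {Q} {u v : Q ⇒ F U} → (∀ {x} (p : x ∈ U) → π p ∘ u ≈ π p ∘ v) → u ≈ v
  F-ext = prod-ext

  AgreeOn : (L : List Var) {U V : List Var} → L ⊆ V → L ⊆ U → F V ⇒ F U → Set e
  AgreeOn L wV wU ι = ∀ {x} (p : x ∈ L) → π (wV p) ≈ π (wU p) ∘ ι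

  mutual
    ⟦⟧t-reindex : ∀ {s} (t : Term s) {U V} (wV : fvt t ⊆ V) (wU : fvt t ⊆ U) (ι : F V ⇒ F U) →
                  AgreeOn (fvt t) wV wU ι → ⟦ t ⟧t wV ≈ ⟦ t ⟧t wU ∘ ι
    ⟦⟧t-reindex (var x) wV wU ι agree = agree (here refl)
    ⟦⟧t-reindex (app f as) wV wU ι agree = ∘-resp-≈ʳ (⟦⟧a-reindex as wV wU ι agree) ○ sym-assoc

    ⟦⟧a-reindex : ∀ {ss} (as : Args ss) {U V} (wV : fvs as ⊆ V) (wU : fvs as ⊆ U) (ι : F V ⇒ F U) →
                  AgreeOn (fvs as) wV wU ι → ⟨ ⟦ as ⟧a wV ⟩ ≈ ⟨ ⟦ as ⟧a wU ⟩ ∘ ι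
    ⟦⟧a-reindex as wV wU ι agree = prod-ext λ p →
      proj∘⟨⟩ _ p ○ ⟦⟧a-reindex-at as wV wU ι agree p ○ ∘-resp-≈ˡ (⟺ (proj∘⟨⟩ _ p)) ○ assoc

    ⟦⟧a-reindex-at : ∀ {ss} (as : Args ss) {U V} (wV : fvs as ⊆ V) (wU : fvs as ⊆ U) (ι : F V ⇒ F U) →
                     AgreeOn (fvs as) wV wU ι → ∀ {s} (p : s ∈ ss) → ⟦ as ⟧a wV p ≈ ⟦ as ⟧a wU p ∘ ι
    ⟦⟧a-reindex-at (t ∷ as) wV wU ι agree (here refl) =
      ⟦⟧t-reindex t (λ p → wV (∈-++⁺ˡ p)) (λ p → wU (∈-++⁺ˡ p)) ι (λ p → agree (∈-++⁺ˡ p))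
    ⟦⟧a-reindex-at (t ∷ as) wV wU ι agree (there q) =
      ⟦⟧a-reindex-at as (λ p → wV (∈-++⁺ʳ (fvt t) p)) (λ p → wU (∈-++⁺ʳ (fvt t) p)) ι
        (λ p → agree (∈-++⁺ʳ (fvt t) p)) q

  remove-⊆-∈-filter⁺ : ∀ y {x} (W : List Var) (x∈W : x ∈ W) (x≢y : ¬ x ≡ y) →
                       remove-⊆ y W (∈-filter⁺ (λ v → ¬? (v ≟ y)) x∈W x≢y) ≡ x∈W
  remove-⊆-∈-filter⁺ y (z ∷ W) (here refl) x≢y with z ≟ y
  ... | no _ = refl
  ... | yes z≡y = ⊥-elim (x≢y z≡y)
  remove-⊆-∈-filter⁺ y (z ∷ W) (there x∈W) x≢y with z ≟ y
  ... | no _ = cong there (remove-⊆-∈-filter⁺ y W x∈W x≢y)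
  ... | yes _ = cong there (remove-⊆-∈-filter⁺ y W x∈W x≢y)

  drop : ∀ y W → F (y ∷ W) ⇒ F W
  drop y W = F⊆ {W} {y ∷ W} there

  π∘drop : ∀ y W {x} (q : x ∈ W) → π q ∘ drop y W ≈ π (there {x = y} q)
  π∘drop y W = π∘F⊆ {W} {y ∷ W} there

  extend : ∀ {Q} y W → Q ⇒ ⟦ T y ⟧ˢ → Q ⇒ F W → Q ⇒ F (y ∷ W)
  extend {Q} y W c a = ⟨ coordinate ⟩
    where
    coordinate : ∀ {x} → x ∈ y ∷ W → Q ⇒ ⟦ T x ⟧ˢ
    coordinate (here refl) = c
    coordinate (there q) = π q ∘ a

  π-here∘extend : ∀ {Q} y W (c : Q ⇒ ⟦ T y ⟧ˢ) (a : Q ⇒ F W) → π {y ∷ W} (here refl) ∘ extend y W c a ≈ c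
  π-here∘extend y W c a = proj∘⟨⟩ _ (here refl)

  π-there∘extend : ∀ {Q} y W (c : Q ⇒ ⟦ T y ⟧ˢ) (a : Q ⇒ F W) {x} (q : x ∈ W) →
                   π (there {x = y} q) ∘ extend y W c a ≈ π q ∘ a
  π-there∘extend y W c a q = proj∘⟨⟩ _ (there q)

  drop∘extend : ∀ {Q} y W (c : Q ⇒ ⟦ T y ⟧ˢ) (a : Q ⇒ F W) → drop y W ∘ extend y W c a ≈ a
  drop∘extend y W c a = F-ext λ q → sym-assoc ○ ∘-resp-≈ˡ (π∘drop y W q) ○ π-there∘extend y W c a q

  extendMap : ∀ y {X Y : List Var} → F X ⇒ F Y → F (y ∷ X) ⇒ F (y ∷ Y)
  extendMap y {X} {Y} k = extend y Y (π {y ∷ X} (here refl)) (k ∘ drop y X)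

  module _ (y : Var) {X Y : List Var} (k : F X ⇒ F Y) where
    drop-square : k ∘ drop y X ≈ drop y Y ∘ extendMap y k
    drop-square = ⟺ (drop∘extend y Y _ _)

    drop-square-weakPullback : ∀ {Q} (a : Q ⇒ F X) (b : Q ⇒ F (y ∷ Y)) → k ∘ a ≈ drop y Y ∘ b →
      Σ[ u ∈ Q ⇒ F (y ∷ X) ] (drop y X ∘ u ≈ a) × (extendMap y k ∘ u ≈ b)
    drop-square-weakPullback a b ka≈b = u , drop∘extend y X _ _ , F-ext π∘extendMap∘u
      where
      u = extend y X (π {y ∷ Y} (here refl) ∘ b) a
      π∘extendMap∘u : ∀ {x} (p : x ∈ y ∷ Y) → π p ∘ (extendMap y k ∘ u) ≈ π p ∘ b
      π∘extendMap∘u (here refl) = sym-assoc ○ ∘-resp-≈ˡ (π-here∘extend y Y _ _) ○ π-here∘extend y X _ _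
      π∘extendMap∘u (there q) =
        sym-assoc ○ ∘-resp-≈ˡ (π-there∘extend y Y _ _ q) ○ assoc
        ○ ∘-resp-≈ʳ (assoc ○ ∘-resp-≈ʳ (drop∘extend y X _ _) ○ ka≈b) ○ sym-assoc ○ ∘-resp-≈ˡ (π∘drop y Y q)

    open BeckChevalley (drop y Y) k (drop y X) (extendMap y k) drop-square drop-square-weakPullback public
      using () renaming (beckChevalley to drop-beckChevalley)

  ∃-body-ctx : ∀ y φ W → fv (∃ᶠ y φ) ⊆ W → fv φ ⊆ (y ∷ W)
  ∃-body-ctx y φ W w {v} p with v ≟ y
  ... | yes refl = here refl
  ... | no v≢y = there (w (∈-filter⁺ (λ v → ¬? (v ≟ y)) p v≢y))

  Reindexable : Formula → Set (h ⊔ e)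
  Reindexable φ = ∀ {U V} (wV : φ ∈Φ V) (wU : φ ∈Φ U) (ι : F V ⇒ F U) →
                  AgreeOn (fv φ) wV wU ι → ⟦ φ ⟧ V wV ≃ ι ⁻¹[ ⟦ φ ⟧ U wU ]

  -- The interpretation of ∃ first restricts the context to W ∖ {y}; Beck–Chevalley removes that detour.
  ⟦∃⟧≃∃drop : ∀ y φ → Reindexable φ → ∀ W (w : fv (∃ᶠ y φ) ⊆ W) →
              ⟦ ∃ᶠ y φ ⟧ W w ≃ ∃[ drop y W ] (⟦ φ ⟧ (y ∷ W) (∃-body-ctx y φ W w))
  ⟦∃⟧≃∃drop y φ reindex W w =
    ≃-trans (drop-beckChevalley y restrict (⟦ φ ⟧ (y ∷ remove y W) (∃-ctx y φ W w)))
            (∃-cong (≃-sym (reindex (∃-body-ctx y φ W w) (∃-ctx y φ W w) (extendMap y restrict) agree)))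
    where
    restrict = F⊆ (remove-⊆ y W)
    agree : AgreeOn (fv φ) (∃-body-ctx y φ W w) (∃-ctx y φ W w) (extendMap y restrict)
    agree {v} p with v ≟ y
    ... | yes refl = ⟺ (π-here∘extend y (remove y W) _ _)
    ... | no v≢y = ⟺ (π-there∘extend y (remove y W) _ _ _ ○ sym-assoc ○ ∘-resp-≈ˡ (π∘F⊆ (remove-⊆ y W) _)
                        ○ ∘-resp-≈ˡ (π-cong (remove-⊆-∈-filter⁺ y W _ v≢y)) ○ π∘drop y W _)

  ⟦⟧-reindex : ∀ φ → Reindexable φ
  ⟦⟧-reindex ⊤ᶠ wV wU ι agree = ⁻¹-⊤ {f = ι}
  ⟦⟧-reindex (φ ∧ᶠ ψ) {U} wV wU ι agree =
    ≃-trans (∧-cong (⟦⟧-reindex φ (λ p → wV (∈-++⁺ˡ p)) (λ p → wU (∈-++⁺ˡ p)) ι (λ p → agree (∈-++⁺ˡ p)))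
                    (⟦⟧-reindex ψ (λ p → wV (∈-++⁺ʳ (fv φ) p)) (λ p → wU (∈-++⁺ʳ (fv φ) p)) ι
                      (λ p → agree (∈-++⁺ʳ (fv φ) p))))
            (≃-sym (⁻¹-∧ {f = ι} {S = ⟦ φ ⟧ U (λ p → wU (∈-++⁺ˡ p))}
                           {T = ⟦ ψ ⟧ U (λ p → wU (∈-++⁺ʳ (fv φ) p))}))
  ⟦⟧-reindex (eqᶠ t u) {U} wV wU ι agree =
    ≃-trans (equalizerₛ-resp-≈ (⟦⟧t-reindex t (λ p → wV (∈-++⁺ˡ p)) (λ p → wU (∈-++⁺ˡ p)) ι
                                  (λ p → agree (∈-++⁺ˡ p)))
                               (⟦⟧t-reindex u (λ p → wV (∈-++⁺ʳ (fvt t) p)) (λ p → wU (∈-++⁺ʳ (fvt t) p)) ι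
                                  (λ p → agree (∈-++⁺ʳ (fvt t) p))))
            (≃-sym (equalizerₛ-⁻¹ {f = ι} {t = ⟦ t ⟧t (λ p → wU (∈-++⁺ˡ p))}
                                    {u = ⟦ u ⟧t (λ p → wU (∈-++⁺ʳ (fvt t) p))}))
  ⟦⟧-reindex (relᶠ R as) wV wU ι agree =
    ≃-trans (⁻¹-resp-≈ {S = ⟦ R ⟧ʳ} (⟦⟧a-reindex as wV wU ι agree))
            (⁻¹-∘ {f = ⟨ ⟦ as ⟧a wU ⟩} {g = ι} {S = ⟦ R ⟧ʳ})
  ⟦⟧-reindex (∃ᶠ y φ) {U} {V} wV wU ι agree =
    ≃-trans (⟦∃⟧≃∃drop y φ (⟦⟧-reindex φ) V wV)
    (≃-trans (∃-cong (⟦⟧-reindex φ (∃-body-ctx y φ V wV) (∃-body-ctx y φ U wU) (extendMap y ι) agree′))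
    (≃-trans (≃-sym (drop-beckChevalley y ι (⟦ φ ⟧ (y ∷ U) (∃-body-ctx y φ U wU))))
             (⁻¹-cong (≃-sym (⟦∃⟧≃∃drop y φ (⟦⟧-reindex φ) U wU)))))
    where
    agree′ : AgreeOn (fv φ) (∃-body-ctx y φ V wV) (∃-body-ctx y φ U wU) (extendMap y ι)
    agree′ {v} p with v ≟ y
    ... | yes refl = ⟺ (π-here∘extend y U _ _)
    ... | no v≢y = ⟺ (π-there∘extend y U _ _ _ ○ sym-assoc ○ ∘-resp-≈ˡ (⟺ (agree _)) ○ π∘drop y V _)

module DuplicateFreeContexts {o h e : Level} (𝐒 : RegularCategory o h e) (Sg : Signature) (Var : Set)
                             (_≟_ : DecidableEquality Var) (T : Var → Signature.Sort Sg)
                             (I : Semantics.Interpretation 𝐒 Sg Var _≟_ T) where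
  open RegularCategory 𝐒
  open Subobjects 𝐒
  open SubobjectCalculus 𝐒
  open Syntax Sg Var _≟_ T
  open Semantics.Interpret 𝐒 Sg Var _≟_ T I
  open Reindexing 𝐒 Sg Var _≟_ T I

  ∈-irrelevant : ∀ {U : List Var} → Unique U → ∀ {x} (p q : x ∈ U) → p ≡ q
  ∈-irrelevant = unique⇒irrelevant (setoid Var) (Decidable⇒UIP.≡-irrelevant _≟_)

  ⟦⟧-irrelevant : ∀ φ {V} → Unique V → (w w' : φ ∈Φ V) → ⟦ φ ⟧ V w ≃ ⟦ φ ⟧ V w'
  ⟦⟧-irrelevant φ uV w w' =
    ≃-trans (⟦⟧-reindex φ w w' id (λ _ → π-cong (∈-irrelevant uV _ _) ○ ⟺ identityʳ)) (id⁻¹ _)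

  ⟦⟧-weaken : ∀ φ {U V} → Unique V → (s : U ⊆ V) (wV : φ ∈Φ V) (wU : φ ∈Φ U) →
              ⟦ φ ⟧ V wV ≃ F⊆ s ⁻¹[ ⟦ φ ⟧ U wU ]
  ⟦⟧-weaken φ uV s wV wU = ⟦⟧-reindex φ wV wU (F⊆ s) (λ _ → π-cong (∈-irrelevant uV _ _) ○ ⟺ (π∘F⊆ s _))

  ∧-∈Φ : ∀ ψ₁ ψ₂ {U} → ψ₁ ∈Φ U → ψ₂ ∈Φ U → (ψ₁ ∧ᶠ ψ₂) ∈Φ U
  ∧-∈Φ ψ₁ ψ₂ w₁ w₂ p with ∈-++⁻ (fv ψ₁) p
  ... | inj₁ q = w₁ q
  ... | inj₂ q = w₂ q

  ⟦∧⟧≃ : ∀ ψ₁ ψ₂ {U} → Unique U → (w₁ : ψ₁ ∈Φ U) (w₂ : ψ₂ ∈Φ U) (w : (ψ₁ ∧ᶠ ψ₂) ∈Φ U) →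
         ⟦ ψ₁ ∧ᶠ ψ₂ ⟧ U w ≃ ⟦ ψ₁ ⟧ U w₁ ∧S ⟦ ψ₂ ⟧ U w₂
  ⟦∧⟧≃ ψ₁ ψ₂ uU w₁ w₂ w = ∧-cong (⟦⟧-irrelevant ψ₁ uU _ w₁) (⟦⟧-irrelevant ψ₂ uU _ w₂)

  ∃* : List Var → Formula → Formula
  ∃* [] ψ = ψ
  ∃* (y ∷ L) ψ = ∃ᶠ y (∃* L ψ)

  fv-∃* : ∀ L ψ {x} → x ∈ fv (∃* L ψ) → x ∈ fv ψ × ¬ x ∈ L
  fv-∃* [] ψ x∈ = x∈ , λ ()
  fv-∃* (y ∷ L) ψ x∈ =
    let (x∈′ , x≢y) = ∈-filter⁻ (λ v → ¬? (v ≟ y)) x∈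
        (x∈ψ , x∉L) = fv-∃* L ψ x∈′
    in x∈ψ , λ { (here x≡y) → x≢y x≡y ; (there x∈L) → x∉L x∈L }

  -- The section (id , π y) of  drop y V  pulls ⟦ ∃ᶠ y χ ⟧ back to a superset of ⟦ χ ⟧.
  ⟦⟧⊑⟦∃⟧ : ∀ χ y {V} → Unique V → y ∈ V → (w : fv χ ⊆ V) (w∃ : fv (∃ᶠ y χ) ⊆ V) →
           ⟦ χ ⟧ V w ⊑ ⟦ ∃ᶠ y χ ⟧ V w∃
  ⟦⟧⊑⟦∃⟧ χ y {V} uV y∈V w w∃ = ⊑-intro (∈ₛ-⊑
    (∈ₛ-resp-≈ (sym-assoc ○ ∘-resp-≈ˡ (drop∘extend y V _ _) ○ identityˡ)
      (∈ₛ-∃ {f = drop y V} (∈ₛ-⁻¹⁻ {f = σ} {S = ⟦ χ ⟧ (y ∷ V) (∃-body-ctx y χ V w∃)} (arr∈ₛ-⊑ (≃⇒⊑ χ≃σ⁻¹χ)))))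
    (≃⇒⊒ (⟦∃⟧≃∃drop y χ (⟦⟧-reindex χ) V w∃)))
    where
    σ = extend y V (π y∈V) id
    agree : AgreeOn (fv χ) w (∃-body-ctx y χ V w∃) σ
    agree {v} p with v ≟ y
    ... | yes refl = π-cong (∈-irrelevant uV _ _) ○ ⟺ (π-here∘extend y V _ _)
    ... | no v≢y = π-cong (∈-irrelevant uV _ _) ○ ⟺ identityʳ ○ ⟺ (π-there∘extend y V _ _ _)
    χ≃σ⁻¹χ = ⟦⟧-reindex χ w (∃-body-ctx y χ V w∃) σ agree

  ⟦⟧⊑⟦∃*⟧ : ∀ ψ {V} → Unique V → ∀ L → L ⊆ V → (w : fv ψ ⊆ V) (w∃ : fv (∃* L ψ) ⊆ V) →
            ⟦ ψ ⟧ V w ⊑ ⟦ ∃* L ψ ⟧ V w∃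
  ⟦⟧⊑⟦∃*⟧ ψ uV [] L⊆V w w∃ = ≃⇒⊑ (⟦⟧-irrelevant ψ uV w w∃)
  ⟦⟧⊑⟦∃*⟧ ψ uV (y ∷ L) L⊆V w w∃ =
    ⊑-trans (⟦⟧⊑⟦∃*⟧ ψ uV L (λ p → L⊆V (there p)) w w′) (⟦⟧⊑⟦∃⟧ (∃* L ψ) y uV (L⊆V (here refl)) w′ w∃)
    where
    w′ : fv (∃* L ψ) ⊆ _
    w′ p = w (proj₁ (fv-∃* L ψ p))

  record DisjointUnion (V L W : List Var) : Set where
    field
      unique-L : Unique L
      unique-W : Unique W
      disjoint : ∀ {x} → x ∈ L → ¬ x ∈ W
      L⊆V : L ⊆ V
      W⊆V : W ⊆ V
      V⊆L∪W : ∀ {x} → x ∈ V → x ∈ L ⊎ x ∈ W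

  shift-head : ∀ {V y L W} → DisjointUnion V (y ∷ L) W → DisjointUnion V L (y ∷ W)
  shift-head {V} {y} {L} {W} split = record
    { unique-L = AllPairs.tail unique-L
    ; unique-W = ¬Any⇒All¬ W (disjoint (here refl)) ∷ unique-W
    ; disjoint = disjoint′
    ; L⊆V = λ p → L⊆V (there p)
    ; W⊆V = W⊆V′
    ; V⊆L∪W = V⊆L∪W′
    }
    where
    open DisjointUnion split
    disjoint′ : ∀ {x} → x ∈ L → ¬ x ∈ y ∷ W
    disjoint′ p (here refl) = lookup (AllPairs.head unique-L) p refl
    disjoint′ p (there q) = disjoint (there p) q
    W⊆V′ : y ∷ W ⊆ V
    W⊆V′ (here refl) = L⊆V (here refl)
    W⊆V′ (there q) = W⊆V q
    V⊆L∪W′ : ∀ {x} → x ∈ V → x ∈ L ⊎ x ∈ y ∷ W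
    V⊆L∪W′ p with V⊆L∪W p
    ... | inj₁ (here refl) = inj₂ (here refl)
    ... | inj₁ (there q) = inj₁ q
    ... | inj₂ q = inj₂ (there q)

  ⟦∃*⟧⊑∃F⊆ : ∀ ψ {V} (w : fv ψ ⊆ V) L W → (split : DisjointUnion V L W) (w∃ : fv (∃* L ψ) ⊆ W) →
             ⟦ ∃* L ψ ⟧ W w∃ ⊑ ∃[ F⊆ (DisjointUnion.W⊆V split) ] (⟦ ψ ⟧ V w)
  ⟦∃*⟧⊑∃F⊆ ψ {V} w [] W split w∃ = ⊑-intro
    (∈ₛ-resp-≈ (sym-assoc ○ ∘-resp-≈ˡ section ○ identityˡ)
      (∈ₛ-∃ {f = F⊆ W⊆V} (∈ₛ-⁻¹⁻ {f = F⊆ V⊆W} {S = ⟦ ψ ⟧ V w} (arr∈ₛ-⊑ (≃⇒⊑ (⟦⟧-weaken ψ unique-W V⊆W w∃ w))))))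
    where
    open DisjointUnion split
    V⊆W : V ⊆ W
    V⊆W p with V⊆L∪W p
    ... | inj₁ ()
    ... | inj₂ q = q
    section : F⊆ W⊆V ∘ F⊆ V⊆W ≈ id
    section = F-ext λ p → sym-assoc ○ ∘-resp-≈ˡ (π∘F⊆ W⊆V p) ○ π∘F⊆ V⊆W (W⊆V p)
                          ○ π-cong (∈-irrelevant unique-W _ _) ○ ⟺ identityʳ
  ⟦∃*⟧⊑∃F⊆ ψ {V} w (y ∷ L) W split w∃ =
    ⊑-trans (≃⇒⊑ (⟦∃⟧≃∃drop y (∃* L ψ) (⟦⟧-reindex (∃* L ψ)) W w∃))
    (⊑-trans (∃-mono {f = drop y W} (⟦∃*⟧⊑∃F⊆ ψ w L (y ∷ W) split′ (∃-body-ctx y (∃* L ψ) W w∃)))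
    (⊑-trans (∃-∘ {f = drop y W} {g = F⊆ (DisjointUnion.W⊆V split′)} {S = ⟦ ψ ⟧ V w})
             (∃-resp-≈ {S = ⟦ ψ ⟧ V w} drop∘F⊆)))
    where
    split′ = shift-head split
    drop∘F⊆ : drop y W ∘ F⊆ (DisjointUnion.W⊆V split′) ≈ F⊆ (DisjointUnion.W⊆V split)
    drop∘F⊆ = F-ext λ q → sym-assoc ○ ∘-resp-≈ˡ (π∘drop y W q) ○ π∘F⊆ _ (there q)
                           ○ ⟺ (π∘F⊆ (DisjointUnion.W⊆V split) q)

module InchwormSemantics {o h e : Level} (𝐒 : RegularCategory o h e) (Sg : Signature) (Var : Set)
       (_≟_ : DecidableEquality Var) (T : Var → Signature.Sort Sg)
       (I : Semantics.Interpretation 𝐒 Sg Var _≟_ T)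
       (X : Pred Var 0ℓ) (𝒦 : SimplicialComplex Var X)
       (_⊢_ : Syntax.FSet Sg Var _≟_ T → Syntax.Formula Sg Var _≟_ T → Set)
       (conservative : Semantics.Interpret.Conservative 𝐒 Sg Var _≟_ T I _⊢_) where
  open RegularCategory 𝐒
  open Subobjects 𝐒
  open SubobjectCalculus 𝐒
  open Syntax Sg Var _≟_ T
  open Semantics.Interpret 𝐒 Sg Var _≟_ T I
  open Reindexing 𝐒 Sg Var _≟_ T I
  open DuplicateFreeContexts 𝐒 Sg Var _≟_ T I
  open DecMembership _≟_ using (_∈?_)
  open SimplicialComplex 𝒦
  open Inchworm Sg Var _≟_ T X 𝒦 _⊢_
  open FilterModels 𝒦

  SubFamily : Set (lsuc (lsuc 0ℓ ⊔ o ⊔ h ⊔ e))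
  SubFamily = (U : List Var) → Sub (F U) → Set (lsuc 0ℓ ⊔ o ⊔ h ⊔ e)

  -- Pass through the face U ∩ U′: push forward along F_{U∩U′ ⊆ U}, then pull back along F_{U∩U′ ⊆ U′}.
  ⊨-transport : (G : SubFamily) → IsFilterModel G → ∀ φ {U U′} → C U → C U′ →
                (w : φ ∈Φ U) (w′ : φ ∈Φ U′) → G U (⟦ φ ⟧ U w) → G U′ (⟦ φ ⟧ U′ w′)
  ⊨-transport G isModel φ {U} {U′} cU cU′ w w′ G∋φ =
    up-closed cU′ (≃⇒⊒ (⟦⟧-weaken φ (C-unique cU′) W⊆U′ w′ wW))
      (proj₁ (restrict-⁻¹ cW cU′ W⊆U′ _)
        (up-closed cW (∃-least {f = F⊆ W⊆U} {S = ⟦ φ ⟧ U w} φ∈F⊆⁻¹φ)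
          (proj₂ (restrict-∃ cW cU W⊆U _) (⟦ φ ⟧ U w , G∋φ , ⊑⇒≤ (⊑-refl {S = ∃φ}) , ⊑⇒≤ (⊑-refl {S = ∃φ})))))
    where
    open IsFilterModel isModel
    up-closed : ∀ {V} → C V → ∀ {S T} → S ⊑ T → G V S → G V T
    up-closed cV S⊑T = IsFilter.up-closed (isFilter cV) (⊑⇒≤ S⊑T)
    in-U′? = λ x → x ∈? U′
    W = filter in-U′? U
    W⊆U : W ⊆ U
    W⊆U p = proj₁ (∈-filter⁻ in-U′? {xs = U} p)
    W⊆U′ : W ⊆ U′
    W⊆U′ p = proj₂ (∈-filter⁻ in-U′? {xs = U} p)
    cW = C-down cU (filter⁺ in-U′? (C-unique cU)) W⊆U
    wW : φ ∈Φ W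
    wW p = ∈-filter⁺ in-U′? (w p) (w′ p)
    ∃φ = ∃[ F⊆ W⊆U ] ⟦ φ ⟧ U w
    φ∈F⊆⁻¹φ = ∈ₛ-⁻¹⁻ {f = F⊆ W⊆U} {S = ⟦ φ ⟧ W wW} (arr∈ₛ-⊑ (≃⇒⊑ (⟦⟧-weaken φ (C-unique cU) W⊆U w wW)))

  ⊢C-sound : ∀ {Γ φ} → Γ ⊢C φ → (G : SubFamily) → IsFilterModel G → G ⊨Γ Γ → G ⊨ φ
  ⊢C-sound {Γ} {φ} (base U cU w Γ∣U⊢φ) G isModel G⊨Γ U′ cU′ w′ =
    ⊨-transport G isModel φ cU cU′ w w′ (IsFilter.up-closed (isFilter cU) ⋀Δ≤φ (G∋⋀ Δ⊆Γ))
    where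
    open IsFilterModel isModel
    ΓU : ∀ ψ → (Γ ∣ U) ψ → ψ ∈Φ U
    ΓU _ = proj₂
    finite = proj₂ (conservative (Γ ∣ U) φ U (C-unique cU) ΓU w) Γ∣U⊢φ
    Δ⊆Γ = proj₁ (proj₂ finite)
    ⋀Δ≤φ = proj₂ (proj₂ finite)
    G∋⋀ : ∀ {Δ} (Δ⊆Γ : All (Γ ∣ U) Δ) → G U (⋀ Δ U (inΦ (Γ ∣ U) U ΓU Δ⊆Γ))
    G∋⋀ [] = IsFilter.has-⊤ (isFilter cU)
    G∋⋀ ((γ , wψ) ∷ Δ⊆Γ) = IsFilter.∧-closed (isFilter cU) (G⊨Γ _ γ U cU wψ) (G∋⋀ Δ⊆Γ)
  ⊢C-sound (cut Γ₁⊢φ Δ₁⊢ψ (Δ₁⊆Δ∪φ , _) (_ , Γ₁∪Δ⊆Γ)) G isModel G⊨Γ =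
    ⊢C-sound Δ₁⊢ψ G isModel G⊨Δ₁
    where
    G⊨φ = ⊢C-sound Γ₁⊢φ G isModel (λ χ γ → G⊨Γ χ (Γ₁∪Δ⊆Γ (inj₁ γ)))
    G⊨Δ₁ : G ⊨Γ _
    G⊨Δ₁ χ δ with Δ₁⊆Δ∪φ δ
    ... | inj₁ δ′ = G⊨Γ χ (Γ₁∪Δ⊆Γ (inj₂ δ′))
    ... | inj₂ refl = G⊨φ

  ⊢-from-⋀ : ∀ {Γ φ U} → C U → (wφ : φ ∈Φ U) (Δ : List Formula) (Δ⊆Γ : All (Γ ∣ U) Δ) →
             ⋀ Δ U (inΦ (Γ ∣ U) U (λ _ → proj₂) Δ⊆Γ) ⊑ ⟦ φ ⟧ U wφ → (Γ ∣ U) ⊢ φ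
  ⊢-from-⋀ {Γ} {φ} {U} cU wφ Δ Δ⊆Γ ⋀Δ⊑φ =
    proj₁ (conservative (Γ ∣ U) φ U (C-unique cU) (λ _ → proj₂) wφ) (Δ , Δ⊆Γ , ⊑⇒≤ ⋀Δ⊑φ)

  ⊢C-by-⊑ : ∀ {Γ ψ φ U} → C U → Γ ψ → (wψ : ψ ∈Φ U) (wφ : φ ∈Φ U) → ⟦ ψ ⟧ U wψ ⊑ ⟦ φ ⟧ U wφ → Γ ⊢C φ
  ⊢C-by-⊑ {ψ = ψ} {U = U} cU γ wψ wφ ψ⊑φ =
    base U cU wφ (⊢-from-⋀ cU wφ (ψ ∷ []) ((γ , wψ) ∷ []) (⊑-trans ∧-⊤-⊑ ψ⊑φ))

  cut-single : ∀ {Γ ψ φ} → Γ ⊢C ψ → ｛ ψ ｝ ⊢C φ → Γ ⊢C φ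
  cut-single {Γ} Γ⊢ψ ψ⊢φ =
    cut {Γ₁ = Γ} {Δ = ∅} Γ⊢ψ ψ⊢φ (inj₂ , λ { (inj₂ eq) → eq }) (inj₁ , λ { (inj₁ γ) → γ })

  cut-assume : ∀ {Γ ψ φ} → Γ ⊢C ψ → (Γ ∪ ｛ ψ ｝) ⊢C φ → Γ ⊢C φ
  cut-assume {Γ} Γ⊢ψ Γψ⊢φ =
    cut {Γ₁ = Γ} {Δ = Γ} Γ⊢ψ Γψ⊢φ ((λ x → x) , (λ x → x)) (inj₁ , λ { (inj₁ γ) → γ ; (inj₂ γ) → γ })

  ⊢C-∧-intro : ∀ {Γ ψ₁ ψ₂ U} → C U → Γ ⊢C ψ₁ → Γ ⊢C ψ₂ → ψ₁ ∈Φ U → ψ₂ ∈Φ U → Γ ⊢C (ψ₁ ∧ᶠ ψ₂)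
  ⊢C-∧-intro {Γ} {ψ₁} {ψ₂} {U} cU ⊢ψ₁ ⊢ψ₂ w₁ w₂ =
    cut-assume ⊢ψ₁ (cut {Γ₁ = Γ} {Δ = Γ ∪ ｛ ψ₁ ｝} ⊢ψ₂ ψ₁ψ₂⊢ψ₁∧ψ₂
      ((λ x → x) , (λ x → x)) (inj₂ , λ { (inj₁ γ) → inj₁ γ ; (inj₂ γ) → γ }))
    where
    w : (ψ₁ ∧ᶠ ψ₂) ∈Φ U
    w = ∧-∈Φ ψ₁ ψ₂ w₁ w₂
    ψ₁ψ₂⊢ψ₁∧ψ₂ : ((Γ ∪ ｛ ψ₁ ｝) ∪ ｛ ψ₂ ｝) ⊢C (ψ₁ ∧ᶠ ψ₂)
    ψ₁ψ₂⊢ψ₁∧ψ₂ = base U cU w (⊢-from-⋀ cU w (ψ₁ ∷ ψ₂ ∷ []) ((inj₁ (inj₂ refl) , w₁) ∷ (inj₂ refl , w₂) ∷ [])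
      (⊑-trans (∧-mono {S = ⟦ ψ₁ ⟧ U w₁} ⊑-refl (∧-⊤-⊑ {S = ⟦ ψ₂ ⟧ U w₂}))
               (≃⇒⊒ (⟦∧⟧≃ ψ₁ ψ₂ (C-unique cU) w₁ w₂ w))))

  module Restriction {U V : List Var} (cU : C U) (cV : C V) (U⊆V : U ⊆ V) where
    outside-U? = λ x → ¬? (x ∈? U)
    V∖U = filter outside-U? V

    V⊆V∖U∪U : ∀ {x} → x ∈ V → x ∈ V∖U ⊎ x ∈ U
    V⊆V∖U∪U {x} p with x ∈? U
    ... | yes x∈U = inj₂ x∈U
    ... | no x∉U = inj₁ (∈-filter⁺ outside-U? p x∉U)

    split : DisjointUnion V V∖U U
    split = record
      { unique-L = filter⁺ outside-U? (C-unique cV)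
      ; unique-W = C-unique cU
      ; disjoint = λ p → proj₂ (∈-filter⁻ outside-U? {xs = V} p)
      ; L⊆V = λ p → proj₁ (∈-filter⁻ outside-U? {xs = V} p)
      ; W⊆V = U⊆V
      ; V⊆L∪W = V⊆V∖U∪U
      }
    open DisjointUnion split using (L⊆V; disjoint)

    ∃*-∈ΦU : ∀ ψ → ψ ∈Φ V → ∃* V∖U ψ ∈Φ U
    ∃*-∈ΦU ψ w p with fv-∃* V∖U ψ p
    ... | x∈ψ , x∉V∖U with V⊆V∖U∪U (w x∈ψ)
    ...   | inj₁ x∈V∖U = ⊥-elim (x∉V∖U x∈V∖U)
    ...   | inj₂ x∈U = x∈U

    ∃*-∈ΦV : ∀ ψ → ψ ∈Φ V → ∃* V∖U ψ ∈Φ V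
    ∃*-∈ΦV ψ w p = w (proj₁ (fv-∃* V∖U ψ p))

    ⟦∃*⟧⊑∃⟦⟧ : ∀ ψ (w : ψ ∈Φ V) → ⟦ ∃* V∖U ψ ⟧ U (∃*-∈ΦU ψ w) ⊑ ∃[ F⊆ U⊆V ] (⟦ ψ ⟧ V w)
    ⟦∃*⟧⊑∃⟦⟧ ψ w = ⟦∃*⟧⊑∃F⊆ ψ w V∖U U split (∃*-∈ΦU ψ w)

    ⊢C-∃* : ∀ ψ → ψ ∈Φ V → ｛ ψ ｝ ⊢C ∃* V∖U ψ
    ⊢C-∃* ψ w = ⊢C-by-⊑ cV refl w (∃*-∈ΦV ψ w) (⟦⟧⊑⟦∃*⟧ ψ (C-unique cV) V∖U L⊆V w (∃*-∈ΦV ψ w))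

    -- Sorts may be empty, so F_V → F_U need not be onto a priori; it is because ⊢ ∃(V∖U). ⊤
    -- and ⟦-⟧ is conservative.
    F⊆-onto : ⊤S ⊑ ∃[ F⊆ U⊆V ] (⊤S {F V})
    F⊆-onto = ⊑-trans (≤⇒⊑ ⊤≤⟦∃*⊤⟧) (⟦∃*⟧⊑∃⟦⟧ ⊤ᶠ ⊤-∈Φ)
      where
      ⊤-∈Φ : ⊤ᶠ ∈Φ V
      ⊤-∈Φ ()
      χ = ∃* V∖U ⊤ᶠ
      ⊢χ : (∅ ∣ V) ⊢ χ
      ⊢χ = ⊢-from-⋀ cV (∃*-∈ΦV ⊤ᶠ ⊤-∈Φ) [] [] (⟦⟧⊑⟦∃*⟧ ⊤ᶠ (C-unique cV) V∖U L⊆V ⊤-∈Φ (∃*-∈ΦV ⊤ᶠ ⊤-∈Φ))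
      ⊤≤⟦∃*⊤⟧ : ⊤S ≤ ⟦ χ ⟧ U (∃*-∈ΦU ⊤ᶠ ⊤-∈Φ)
      ⊤≤⟦∃*⊤⟧ with proj₂ (conservative (∅ ∣ V) χ U (C-unique cU) (λ _ ()) (∃*-∈ΦU ⊤ᶠ ⊤-∈Φ)) ⊢χ
      ... | [] , [] , ⊤≤χ = ⊤≤χ

  module TermModel (Γ : FSet) where
    Provable : SubFamily
    Provable U S = Lift o (Σ[ ψ ∈ Formula ] (Γ ⊢C ψ) × Σ[ w ∈ ψ ∈Φ U ] (⟦ ψ ⟧ U w ⊑ S))

    Provable-⊑ : ∀ {U} {S T : Sub (F U)} → Provable U S → S ⊑ T → Provable U T
    Provable-⊑ (lift (ψ , ⊢ψ , w , ψ⊑S)) S⊑T = lift (ψ , ⊢ψ , w , ⊑-trans ψ⊑S S⊑T)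

    Provable-⁻¹ : ∀ {U V} → C V → (s : U ⊆ V) → ∀ {S} → Provable U S → Provable V (F⊆ s ⁻¹[ S ])
    Provable-⁻¹ cV s (lift (ψ , ⊢ψ , w , ψ⊑S)) =
      lift (ψ , ⊢ψ , (λ p → s (w p)) , ⊑-trans (≃⇒⊑ (⟦⟧-weaken ψ (C-unique cV) s _ w)) (⁻¹-mono ψ⊑S))

    Provable-∃ : ∀ {U V} → C U → C V → (s : U ⊆ V) → ∀ {S} → Provable V S → Provable U (∃[ F⊆ s ] S)
    Provable-∃ cU cV s (lift (ψ , ⊢ψ , w , ψ⊑S)) =
      lift (∃* V∖U ψ , cut-single ⊢ψ (⊢C-∃* ψ w) , ∃*-∈ΦU ψ w , ⊑-trans (⟦∃*⟧⊑∃⟦⟧ ψ w) (∃-mono ψ⊑S))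
      where open Restriction cU cV s

    Provable-⊤ : ∀ {U} → C U → Provable U ⊤S
    Provable-⊤ {U} cU = lift (⊤ᶠ , base U cU ⊤-∈Φ (⊢-from-⋀ cU ⊤-∈Φ [] [] ⊑-refl) , ⊤-∈Φ , ⊑-refl)
      where
      ⊤-∈Φ : ⊤ᶠ ∈Φ U
      ⊤-∈Φ ()

    Provable-∧ : ∀ {U} → C U → ∀ {S T} → Provable U S → Provable U T → Provable U (S ∧S T)
    Provable-∧ {U} cU (lift (ψ₁ , ⊢ψ₁ , w₁ , ψ₁⊑S)) (lift (ψ₂ , ⊢ψ₂ , w₂ , ψ₂⊑T)) =
      lift (ψ₁ ∧ᶠ ψ₂ , ⊢C-∧-intro cU ⊢ψ₁ ⊢ψ₂ w₁ w₂ , w ,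
            ⊑-trans (≃⇒⊑ (⟦∧⟧≃ ψ₁ ψ₂ (C-unique cU) w₁ w₂ w)) (∧-mono ψ₁⊑S ψ₂⊑T))
      where
      w : (ψ₁ ∧ᶠ ψ₂) ∈Φ U
      w = ∧-∈Φ ψ₁ ψ₂ w₁ w₂

    Provable-isFilterModel : IsFilterModel Provable
    Provable-isFilterModel = record
      { isFilter = λ cU → record
        { has-⊤ = Provable-⊤ cU
        ; up-closed = λ S≤T G∋S → Provable-⊑ G∋S (≤⇒⊑ S≤T)
        ; ∧-closed = Provable-∧ cU
        }
      ; restrict-⁻¹ = λ cU cV s S →
          Provable-⁻¹ cV s , λ G∋s⁻¹S → Provable-⊑ (Provable-∃ cU cV s G∋s⁻¹S) ∃⊣⁻¹-counit
      ; restrict-∃ = λ cU cV s S →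
          (λ G∋S → F⊆ s ⁻¹[ S ] , Provable-⁻¹ cV s G∋S ,
                    ⊑⇒≤ (onto⇒⊑∃⁻¹ (Restriction.F⊆-onto cU cV s) S) , ⊑⇒≤ (∃⊣⁻¹-counit {f = F⊆ s} {S = S}))
        , (λ { (S′ , G∋S′ , _ , ∃S′≤S) → Provable-⊑ (Provable-∃ cU cV s G∋S′) (≤⇒⊑ ∃S′≤S) })
      }

    Provable-⊨Γ : Provable ⊨Γ Γ
    Provable-⊨Γ ψ γ U cU w = lift (ψ , ⊢C-by-⊑ cU γ w w ⊑-refl , w , ⊑-refl)

    ⊢C-complete : ∀ φ → InΦC φ → (∀ (G : SubFamily) → IsFilterModel G → G ⊨Γ Γ → G ⊨ φ) → Γ ⊢C φ
    ⊢C-complete φ (U , cU , wφ) valid with valid Provable Provable-isFilterModel Provable-⊨Γ U cU wφ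
    ... | lift (ψ , ⊢ψ , wψ , ψ⊑φ) = cut-single ⊢ψ (⊢C-by-⊑ cU refl wψ wφ ψ⊑φ)

lemma30 :
    ∀ {o h e : Level}
      (𝐒 : RegularCategory o h e)
      (Sg : Signature) (Var : Set) (_≟_ : DecidableEquality Var)
      (T : Var → Signature.Sort Sg)
      (X : Pred Var 0ℓ) (𝒦 : SimplicialComplex Var X)
      (_⊢_ : Syntax.FSet Sg Var _≟_ T → Syntax.Formula Sg Var _≟_ T → Set)
      (I : Semantics.Interpretation 𝐒 Sg Var _≟_ T) →
      Semantics.Interpret.Conservative 𝐒 Sg Var _≟_ T I _⊢_ →
      ∀ (Γ : Syntax.FSet Sg Var _≟_ T) (φ : Syntax.Formula Sg Var _≟_ T) →
      (∀ ψ → Γ ψ → Semantics.Interpret.FilterModels.InΦC 𝐒 Sg Var _≟_ T I 𝒦 ψ) →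
      Semantics.Interpret.FilterModels.InΦC 𝐒 Sg Var _≟_ T I 𝒦 φ →
      (Inchworm._⊢C_ Sg Var _≟_ T X 𝒦 _⊢_ Γ φ →
        ∀ (G : (U : List Var) → Subobjects.Sub 𝐒 (Semantics.Interpret.F 𝐒 Sg Var _≟_ T I U) → Set (Level.suc 0ℓ ⊔ o ⊔ h ⊔ e)) →
        Semantics.Interpret.FilterModels.IsFilterModel 𝐒 Sg Var _≟_ T I 𝒦 G →
        Semantics.Interpret.FilterModels._⊨Γ_ 𝐒 Sg Var _≟_ T I 𝒦 G Γ →
        Semantics.Interpret.FilterModels._⊨_ 𝐒 Sg Var _≟_ T I 𝒦 G φ)
      ×
      ((∀ (G : (U : List Var) → Subobjects.Sub 𝐒 (Semantics.Interpret.F 𝐒 Sg Var _≟_ T I U) → Set (Level.suc 0ℓ ⊔ o ⊔ h ⊔ e)) →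
        Semantics.Interpret.FilterModels.IsFilterModel 𝐒 Sg Var _≟_ T I 𝒦 G →
        Semantics.Interpret.FilterModels._⊨Γ_ 𝐒 Sg Var _≟_ T I 𝒦 G Γ →
        Semantics.Interpret.FilterModels._⊨_ 𝐒 Sg Var _≟_ T I 𝒦 G φ) →
       Inchworm._⊢C_ Sg Var _≟_ T X 𝒦 _⊢_ Γ φ)

lemma30 𝐒 Sg Var _≟_ T X 𝒦 _⊢_ I conservative Γ φ _ φ∈ΦC =
  (λ Γ⊢Cφ G → ⊢C-sound Γ⊢Cφ G) , ⊢C-complete φ φ∈ΦC
  where
  open InchwormSemantics 𝐒 Sg Var _≟_ T I X 𝒦 _⊢_ conservative
  open TermModel Γ
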